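{- Let $X$ be a finite set and let $d:\mathbb{A}(X)\times\mathbb{A}(X)\to[0,\infty)$ be a semimetric satisfying Axioms 1 and 3 below. Then $d(\succsim_{ab},\succsim_{ab}^{+})=d(\succsim_{cb},\succsim_{cb}^{+})$ for all pairwise distinct $a,b,c\in X$. Axiom 1: for all $\succsim,\succsim_0,\trianglerighteq\in\mathbb{A}(X)$ such that $\succsim_0$ is in-between $\succsim$ and $\trianglerighteq$, $d(\succsim,\trianglerighteq)=d(\succsim,\succsim_0)+d(\succsim_0,\trianglerighteq)$. Axiom 3: for all $\succsim\in\mathbb{A}(X)$ and distinct $a,b\in X$: if neither $a\succ b$ nor $b\succ a$ and $\succsim\oplus(a,b)$ is defined, then $d(\succsim,\succsim\oplus(a,b))=2^{N(b,\succsim)-1}d(\succsim_{ab},\succsim_{ab}^{+})$; and if $a\succ b$, then $d(\succsim,\succsim\ominus(a,b))=2^{N(b,\succsim)}d(\succsim_{ab},\succsim_{ab}^{+})$.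
   Context: A binary relation on $X$ is a nonempty subset $R\subseteq X\times X$; write $x\,R\,y$ for $(x,y)\in R$. Its asymmetric part $R^>$: $x\,R^>\,y$ iff $x\,R\,y$ and not $y\,R\,x$; its symmetric part is $R\setminus R^>$. $\mathrm{Inc}(R)$ is the set of $(x,y)$ with neither $x\,R\,y$ nor $y\,R\,x$. $R$ is acyclic if there are no pairwise distinct $z_1,\dots,z_k$ with $z_1\,R^>\,z_2\cdots R^>\,z_k\,R^>\,z_1$. An acyclic order is a reflexive acyclic relation; $\mathbb{A}(X)$ is the set of acyclic orders on $X$. For $\succsim$ (resp. $\trianglerighteq$), $\succ$ (resp. $\vartriangleright$) is its asymmetric part and $\sim$ its symmetric part. Perturbations: for $\succsim\in\mathbb{A}(X)$ and $a\neq b$: if neither $a\succ b$ nor $b\succ a$, let $R:=\succsim\cup\{(a,b)\}$ if $(a,b)\in\mathrm{Inc}(\succsim)$ and $R:=\succsim\setminus\{(b,a)\}$ if $a\sim b$; if $R$ is acyclic, $\succsim\oplus(a,b):=R$ (otherwise undefined). If $a\succ b$, $\succsim\ominus(a,b):=\succsim\setminus\{(a,b)\}$. We write $\succsim\,\rightarrow\,\succsim_0\,\twoheadrightarrow\,\trianglerighteq$ if either (i) for some $a\succ b$: $\succsim_0=\succsim\ominus(a,b)$, not $a\vartriangleright b$, and $x\succ b$ for every $x$ with $x\vartriangleright b$; or (ii) for some distinct $a,b$ with $(a,b)\in\mathrm{Inc}(\succ)$: $\succsim\oplus(a,b)$ is defined, equals $\succsim_0$, and $a\vartriangleright b$. $\succsim_*$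 is in-between $\succsim$ and $\trianglerighteq$ if there are $n\ge1$ and $\succsim_0,\dots,\succsim_{n-1}\in\mathbb{A}(X)$ with $\succsim_{n-1}=\succsim_*$, $\succsim\rightarrow\succsim_0\twoheadrightarrow\trianglerighteq$, and $\succsim_{k-1}\rightarrow\succsim_k\twoheadrightarrow\trianglerighteq$ for $k=1,\dots,n-1$. For distinct $a,b\in X$, $\succsim_{ab}$ is the partial order $\Delta_X\cup\big((X\setminus\{a,b\})\times\{a,b\}\big)$ ($\Delta_X$ the diagonal) and $\succsim_{ab}^+:=\succsim_{ab}\cup\{(a,b)\}$. For $b\in X$, $N(b,\succsim)$ is the number of $x\in X\setminus\{b\}$ such that not $x\succ b$. A semimetric is a map $d:Z\times Z\to[0,\infty)$ with $d(z,z)=0$, symmetric, satisfying the triangle inequality. -}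

module Defs where

open import Data.Nat using (ℕ; zero; suc; _∸_)
open import Data.Bool using (Bool; true; false; _∧_; _∨_; not; if_then_else_; T)
open import Data.Fin using (Fin; _≟_)
open import Data.List using (List; []; _∷_; map; allFin)
open import Data.Nat.ListAction using (sum)
open import Data.List.Relation.Unary.Unique.Propositional using (Unique)
open import Data.Product using (Σ; ∃; _×_; _,_)
open import Data.Sum using (_⊎_)
open import Relation.Nullary using (¬_)
open import Relation.Nullary.Decidable using (⌊_⌋)
open import Relation.Binary.PropositionalEquality using (_≡_; _≢_)
open import Algebra.Structures using (IsCommutativeRing)
open import Relation.Binary.Structures using (IsTotalOrder)

-- Value domain: an ordered field (the paper uses ℝ)

record OrderedField : Set₁ where
  infixl 6 _+_
  infixl 7 _*_
  infix 4 _≈_ _≤_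
  field
    Carrier : Set
    _≈_ : Carrier → Carrier → Set
    _≤_ : Carrier → Carrier → Set
    _+_ : Carrier → Carrier → Carrier
    _*_ : Carrier → Carrier → Carrier
    -_  : Carrier → Carrier
    0#  : Carrier
    1#  : Carrier
    isCommutativeRing : IsCommutativeRing _≈_ _+_ _*_ -_ 0# 1#
    isTotalOrder      : IsTotalOrder _≈_ _≤_
    +-monoˡ-≤  : ∀ x y z → x ≤ y → x + z ≤ y + z
    *-nonneg   : ∀ x y → 0# ≤ x → 0# ≤ y → 0# ≤ x * y
    0≉1        : ¬ (0# ≈ 1#)
    *-inverse  : ∀ x → ¬ (x ≈ 0#) → ∃ λ y → x * y ≈ 1#

  pow2 : ℕ → Carrier
  pow2 zero    = 1#
  pow2 (suc k) = (1# + 1#) * pow2 k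

-- Binary relations on X = Fin n, as Boolean matrices (subsets of X × X)

Rel : ℕ → Set
Rel n = Fin n → Fin n → Bool

module _ {n : ℕ} where

  _==_ : Fin n → Fin n → Bool
  x == y = ⌊ x ≟ y ⌋

  _∋_⟨_⟩ : Rel n → Fin n → Fin n → Set
  R ∋ x ⟨ y ⟩ = T (R x y)

  Strict : Rel n → Fin n → Fin n → Set
  Strict R x y = T (R x y) × ¬ T (R y x)

  Sym : Rel n → Fin n → Fin n → Set
  Sym R x y = T (R x y) × T (R y x)

  Inc : Rel n → Fin n → Fin n → Set
  Inc R x y = ¬ T (R x y) × ¬ T (R y x)

  IncStrict : Rel n → Fin n → Fin n → Set
  IncStrict R x y = ¬ Strict R x y × ¬ Strict R y x

  Chain : Rel n → Fin n → List (Fin n) → Fin n → Set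
  Chain R x []       y = Strict R x y
  Chain R x (w ∷ ws) y = Strict R x w × Chain R w ws y

  Acyclic : Rel n → Set
  Acyclic R = ∀ z zs → Unique (z ∷ zs) → ¬ Chain R z zs z

  Reflexive : Rel n → Set
  Reflexive R = ∀ x → T (R x x)

  IsAO : Rel n → Set
  IsAO R = Reflexive R × Acyclic R

  -- the candidate relation R for ≿ ⊕ (a,b) (used when neither a ≻ b nor b ≻ a):
  -- if a ∼ b remove (b,a); if (a,b) ∈ Inc add (a,b)
  plus : Rel n → Fin n → Fin n → Rel n
  plus R a b x y =
    if R a b then R x y ∧ not ((x == b) ∧ (y == a))
             else R x y ∨ ((x == a) ∧ (y == b))

  minus : Rel n → Fin n → Fin n → Rel n
  minus R a b x y = R x y ∧ not ((x == a) ∧ (y == b))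

  Step : Rel n → Rel n → Rel n → Set
  Step R R₀ U =
      (Σ (Fin n) λ a → Σ (Fin n) λ b →
          Strict R a b × (∀ x y → R₀ x y ≡ minus R a b x y)
        × ¬ Strict U a b × (∀ x → Strict U x b → Strict R x b))
    ⊎ (Σ (Fin n) λ a → Σ (Fin n) λ b →
          a ≢ b × IncStrict R a b × Acyclic (plus R a b)
        × (∀ x y → R₀ x y ≡ plus R a b x y) × Strict U a b)

  data Reach (R U : Rel n) : Rel n → Set where
    first : ∀ {S} → IsAO S → Step R S U → Reach R U S
    next  : ∀ {S S′} → Reach R U S → IsAO S′ → Step S S′ U → Reach R U S′

  InBetween : Rel n → Rel n → Rel n → Set
  InBetween S R U = Reach R U S

  ≿ab : Fin n → Fin n → Rel n
  ≿ab a b x y = (x == y) ∨ (not (x == a) ∧ not (x == b) ∧ ((y == a) ∨ (y == b)))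

  ≿ab⁺ : Fin n → Fin n → Rel n
  ≿ab⁺ a b x y = ≿ab a b x y ∨ ((x == a) ∧ (y == b))

  StrictB : Rel n → Fin n → Fin n → Bool
  StrictB R x y = R x y ∧ not (R y x)

  N : Fin n → Rel n → ℕ
  N b R = sum (map (λ x → if not (x == b) ∧ not (StrictB R x b) then 1 else 0) (allFin n))

module _ (F : OrderedField) {n : ℕ} (d : Rel n → Rel n → OrderedField.Carrier F) where
  open OrderedField F

  -- d is a function of relations as sets
  Extensional : Set
  Extensional = ∀ R R′ S S′ → (∀ x y → R x y ≡ R′ x y) → (∀ x y → S x y ≡ S′ x y)
                → d R S ≈ d R′ S′

  Semimetric : Set
  Semimetric =
      (∀ R → IsAO R → d R R ≈ 0#)
    × (∀ R S → IsAO R → IsAO S → 0# ≤ d R S)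
    × (∀ R S → IsAO R → IsAO S → d R S ≈ d S R)
    × (∀ R S U → IsAO R → IsAO S → IsAO U → d R U ≤ d R S + d S U)

  Axiom1 : Set
  Axiom1 = ∀ R R₀ U → IsAO R → IsAO R₀ → IsAO U → InBetween R₀ R U
           → d R U ≈ d R R₀ + d R₀ U

  Axiom3 : Set
  Axiom3 =
      (∀ R a b → IsAO R → a ≢ b → ¬ Strict R a b → ¬ Strict R b a → Acyclic (plus R a b)
         → d R (plus R a b) ≈ pow2 (N b R ∸ 1) * d (≿ab a b) (≿ab⁺ a b))
    × (∀ R a b → IsAO R → Strict R a b
         → d R (minus R a b) ≈ pow2 (N b R) * d (≿ab a b) (≿ab⁺ a b))

-- Start from the order in which b lies strictly below every other element and no other
-- pair is comparable, and delete first (a,b) and then (c,b). The middle order is in-between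
-- the two ends (the first deletion is a step of kind (i)), and N(b,·) is 0 before the first
-- deletion and 1 after it, so Axioms 1 and 3 give distance δ(a,b) + 2 δ(c,b) between the
-- ends, where δ(x,b) = d(≿_xb, ≿_xb⁺). Deleting in the other order reaches the same relation
-- and gives δ(c,b) + 2 δ(a,b), whence δ(a,b) = δ(c,b).
module Submission where

open import Defs
open import Data.Nat using (ℕ; zero; suc; _<_; z<s)
import Data.Nat as ℕ
open import Data.Nat.Properties using (<-trans; <-irrefl; <-asym)
open import Data.Fin using (Fin; _≟_)
open import Data.Bool using (true; false; _∧_; _∨_; not; if_then_else_; T)
open import Data.Bool.Properties using (∧-assoc; ∧-comm; ∧-zeroʳ; ∨-zeroʳ; T-∧)
open import Data.Unit using (tt)
open import Data.List using ([]; _∷_; map; allFin; tabulate)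
open import Data.List.Properties using (map-tabulate; tabulate-cong)
open import Data.Nat.ListAction using (sum)
open import Data.Product using (_,_; _×_; proj₁; proj₂)
open import Data.Sum using (inj₁)
open import Data.Empty using (⊥-elim)
open import Function using (_∘_; id; Equivalence)
open import Relation.Nullary using (¬_; yes; no)
open import Relation.Nullary.Decidable using (isYes≗does; dec-true; dec-false; ⌊⌋-map′; toWitness)
open import Relation.Binary.PropositionalEquality
  using (_≡_; _≢_; refl; sym; trans; cong; cong₂; subst; module ≡-Reasoning)
open import Algebra.Bundles using (CommutativeRing)
import Algebra.Properties.Group as GroupProperties
open import Algebra.Structures using (IsCommutativeRing)
import Relation.Binary.Reasoning.Setoid as SetoidReasoning

private
  variable
    n : ℕ

==-refl : (x : Fin n) → (x == x) ≡ true
==-refl x = trans (isYes≗does (x ≟ x)) (dec-true (x ≟ x) refl)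

==-≢ : {x y : Fin n} → x ≢ y → (x == y) ≡ false
==-≢ {x = x} {y} x≢y = trans (isYes≗does (x ≟ y)) (dec-false (x ≟ y) x≢y)

==-suc : (x y : Fin n) → (Fin.suc x == Fin.suc y) ≡ (x == y)
==-suc x y = ⌊⌋-map′ _ _ (x ≟ y)

T-==⇒≡ : {x y : Fin n} → T (x == y) → x ≡ y
T-==⇒≡ {x = x} {y} = toWitness {a? = x ≟ y}

sum-tabulate-zero : ∀ n {f : Fin n → ℕ} → (∀ x → f x ≡ 0) → sum (tabulate f) ≡ 0
sum-tabulate-zero zero    f≗0 = refl
sum-tabulate-zero (suc n) f≗0 = cong₂ ℕ._+_ (f≗0 Fin.zero) (sum-tabulate-zero n (f≗0 ∘ Fin.suc))

sum-tabulate-indicator : (a : Fin n) → sum (tabulate (λ x → if x == a then 1 else 0)) ≡ 1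
sum-tabulate-indicator {suc m} Fin.zero =
  cong suc (sum-tabulate-zero m (λ _ → refl))
sum-tabulate-indicator {suc m} (Fin.suc a) = begin
  sum (tabulate (λ x → if Fin.suc x == Fin.suc a then 1 else 0))
    ≡⟨ cong sum (tabulate-cong (λ x → cong (if_then 1 else 0) (==-suc x a))) ⟩
  sum (tabulate (λ x → if x == a then 1 else 0))
    ≡⟨ sum-tabulate-indicator a ⟩
  1 ∎
  where open ≡-Reasoning

sum-allFin : (f : Fin n → ℕ) → sum (map f (allFin n)) ≡ sum (tabulate f)
sum-allFin f = cong sum (map-tabulate id f)

StrictB-true : {R : Rel n} {x y : Fin n} → Strict R x y → StrictB R x y ≡ true
StrictB-true {R = R} {x} {y} (x≿y , y⋡x) with R x y | R y x
... | true | false = refl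
... | true | true  = ⊥-elim (y⋡x tt)

StrictB-false : {R : Rel n} {x y : Fin n} → ¬ Strict R x y → StrictB R x y ≡ false
StrictB-false {R = R} {x} {y} x⊁y with R x y | R y x
... | true  | false = ⊥-elim (x⊁y (tt , λ ()))
... | true  | true  = refl
... | false | _     = refl

N-summand : Rel n → Fin n → Fin n → ℕ
N-summand R b x = if not (x == b) ∧ not (StrictB R x b) then 1 else 0

N≡0 : {R : Rel n} (b : Fin n) → (∀ x → x ≢ b → Strict R x b) → N b R ≡ 0
N≡0 {R = R} b above = trans (sum-allFin (N-summand R b)) (sum-tabulate-zero _ count-x≡0)
  where
  count-x≡0 : ∀ x → N-summand R b x ≡ 0
  count-x≡0 x with x ≟ b
  ... | yes refl = refl
  ... | no x≢b   = cong (λ s → if not s then 1 else 0) (StrictB-true {R = R} (above x x≢b))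

N≡1 : {R : Rel n} {a b : Fin n} → a ≢ b → ¬ Strict R a b →
      (∀ x → x ≢ a → x ≢ b → Strict R x b) → N b R ≡ 1
N≡1 {R = R} {a} {b} a≢b a⊁b above =
  trans (sum-allFin (N-summand R b))
        (trans (cong sum (tabulate-cong count-x≡[x≡a])) (sum-tabulate-indicator a))
  where
  count-x≡[x≡a] : ∀ x → N-summand R b x ≡ (if x == a then 1 else 0)
  count-x≡[x≡a] x with x ≟ a | x ≟ b
  ... | yes refl | yes a≡b  = ⊥-elim (a≢b a≡b)
  ... | yes refl | no _     = cong (λ s → if not s then 1 else 0) (StrictB-false {R = R} a⊁b)
  ... | no _     | yes refl = refl
  ... | no x≢a   | no x≢b   =
    cong (λ s → if not s then 1 else 0) (StrictB-true {R = R} (above x x≢a x≢b))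

_⊆_ : Rel n → Rel n → Set
R ⊆ S = ∀ x y → T (R x y) → T (S x y)

Descending : (Fin n → ℕ) → Rel n → Set
Descending ρ R = ∀ x y → T (R x y) → x ≢ y → ρ y < ρ x

Strict⇒≢ : {R : Rel n} {x y : Fin n} → Strict R x y → x ≢ y
Strict⇒≢ (x≿y , y⋡x) refl = y⋡x x≿y

chain-descends : {ρ : Fin n → ℕ} {R : Rel n} → Descending ρ R →
                 ∀ x ws y → Chain R x ws y → ρ y < ρ x
chain-descends {R = R} desc x []       y x≻y          =
  desc x y (proj₁ x≻y) (Strict⇒≢ {R = R} x≻y)
chain-descends {R = R} desc x (w ∷ ws) y (x≻w , w≻…y) =
  <-trans (chain-descends desc w ws y w≻…y) (desc x w (proj₁ x≻w) (Strict⇒≢ {R = R} x≻w))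

descending⇒acyclic : {ρ : Fin n → ℕ} {R : Rel n} → Descending ρ R → Acyclic R
descending⇒acyclic desc z zs _ z≻…z = <-irrefl refl (chain-descends desc z zs z z≻…z)

descending-⊆ : {ρ : Fin n → ℕ} {R S : Rel n} → S ⊆ R → Descending ρ R → Descending ρ S
descending-⊆ S⊆R desc x y xSy = desc x y (S⊆R x y xSy)

descending⇒strict : {ρ : Fin n → ℕ} {R : Rel n} → Descending ρ R →
                    (x y : Fin n) → T (R x y) → x ≢ y → Strict R x y
descending⇒strict desc x y xRy x≢y =
  xRy , λ yRx → <-asym (desc x y xRy x≢y) (desc y x yRx (x≢y ∘ sym))

Strict-⊆ : {ρ : Fin n → ℕ} {R S : Rel n} → S ⊆ R → Descending ρ R →
           (x y : Fin n) → Strict S x y → Strict R x y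
Strict-⊆ {S = S} S⊆R desc x y x≻y =
  descending⇒strict desc x y (S⊆R x y (proj₁ x≻y)) (Strict⇒≢ {R = S} x≻y)

minus-⊆ : (R : Rel n) (a b : Fin n) → minus R a b ⊆ R
minus-⊆ R a b x y = proj₁ ∘ Equivalence.to T-∧

minus-keeps : (R : Rel n) (a b x y : Fin n) → ¬ (x ≡ a × y ≡ b) → T (R x y) → T (minus R a b x y)
minus-keeps R a b x y ≢ab xRy with x ≟ a | y ≟ b
... | yes x≡a | yes y≡b = ⊥-elim (≢ab (x≡a , y≡b))
... | yes _   | no _    = Equivalence.from T-∧ (xRy , tt)
... | no _    | _       = Equivalence.from T-∧ (xRy , tt)

minus-removes : (R : Rel n) (a b : Fin n) → ¬ T (minus R a b a b)
minus-removes R a b rewrite ==-refl a | ==-refl b | ∧-zeroʳ (R a b) = λ ()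

minus-comm : (R : Rel n) (a b c e x y : Fin n) →
             minus (minus R a b) c e x y ≡ minus (minus R c e) a b x y
minus-comm R a b c e x y = begin
  (R x y ∧ p) ∧ q ≡⟨ ∧-assoc (R x y) p q ⟩
  R x y ∧ (p ∧ q) ≡⟨ cong (R x y ∧_) (∧-comm p q) ⟩
  R x y ∧ (q ∧ p) ≡⟨ ∧-assoc (R x y) q p ⟨
  (R x y ∧ q) ∧ p ∎
  where
  open ≡-Reasoning
  p = not ((x == a) ∧ (y == b))
  q = not ((x == c) ∧ (y == e))

minus-reflexive : {R : Rel n} {a b : Fin n} → a ≢ b → Reflexive R → Reflexive (minus R a b)
minus-reflexive {R = R} {a} {b} a≢b refl-R x =
  minus-keeps R a b x x (λ (x≡a , x≡b) → a≢b (trans (sym x≡a) x≡b)) (refl-R x)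

≿min : Fin n → Rel n
≿min b x y = (x == y) ∨ (y == b)

rank : Fin n → Fin n → ℕ
rank b x = if x == b then 0 else 1

≿min-descending : (b : Fin n) → Descending (rank b) (≿min b)
≿min-descending b x y xRy x≢y rewrite ==-≢ x≢y with T-==⇒≡ xRy
... | refl rewrite ==-refl y | ==-≢ x≢y = z<s

≿min-isAO : (b : Fin n) → IsAO (≿min b)
≿min-isAO b = (λ x → subst (λ v → T (v ∨ (x == b))) (sym (==-refl x)) tt)
            , descending⇒acyclic (≿min-descending b)

≿min-strict : {b x : Fin n} → x ≢ b → Strict (≿min b) x b
≿min-strict {b = b} {x} x≢b = descending⇒strict (≿min-descending b) x b x≿b x≢b
  where
  x≿b : T (≿min b x b)
  x≿b = subst T (sym (trans (cong ((x == b) ∨_) (==-refl b)) (∨-zeroʳ (x == b)))) tt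

module DeleteTwice (F : OrderedField) {n : ℕ} (d : Rel n → Rel n → OrderedField.Carrier F)
                   (axiom1 : Axiom1 F d) (axiom3 : Axiom3 F d) where
  open OrderedField F

  d-deleteTwice : {a b c : Fin n} → a ≢ b → c ≢ b → a ≢ c →
                  d (≿min b) (minus (minus (≿min b) a b) c b)
                    ≈ pow2 0 * d (≿ab a b) (≿ab⁺ a b) + pow2 1 * d (≿ab c b) (≿ab⁺ c b)
  d-deleteTwice {a} {b} {c} a≢b c≢b a≢c =
    ≈-trans (axiom1 U R₁ R₀ (≿min-isAO b) isAO-R₁ isAO-R₀ (first isAO-R₁ U→R₁↠R₀))
          (+-cong d-U-R₁ d-R₁-R₀)
    where
    open IsCommutativeRing isCommutativeRing using (+-cong) renaming (trans to ≈-trans)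

    U R₁ R₀ : Rel n
    U  = ≿min b
    R₁ = minus U a b
    R₀ = minus R₁ c b

    R₀⊆R₁ : R₀ ⊆ R₁
    R₀⊆R₁ = minus-⊆ R₁ c b

    R₁⊆U : R₁ ⊆ U
    R₁⊆U = minus-⊆ U a b

    R₀⊆U : R₀ ⊆ U
    R₀⊆U x y = R₁⊆U x y ∘ R₀⊆R₁ x y

    desc : Descending (rank b) U
    desc = ≿min-descending b

    isAO-R₁ : IsAO R₁
    isAO-R₁ = minus-reflexive {R = U} a≢b (proj₁ (≿min-isAO b))
            , descending⇒acyclic (descending-⊆ R₁⊆U desc)

    isAO-R₀ : IsAO R₀
    isAO-R₀ = minus-reflexive {R = R₁} c≢b (proj₁ isAO-R₁)
            , descending⇒acyclic (descending-⊆ R₀⊆U desc)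

    R₁-c≻b : Strict R₁ c b
    R₁-c≻b = descending⇒strict (descending-⊆ R₁⊆U desc) c b
               (minus-keeps U a b c b (λ (c≡a , _) → a≢c (sym c≡a)) (proj₁ (≿min-strict c≢b)))
               c≢b

    R₁-x≻b : ∀ x → x ≢ a → x ≢ b → Strict R₁ x b
    R₁-x≻b x x≢a x≢b = descending⇒strict (descending-⊆ R₁⊆U desc) x b
                         (minus-keeps U a b x b (λ (x≡a , _) → x≢a x≡a) (proj₁ (≿min-strict x≢b)))
                         x≢b

    U→R₁↠R₀ : Step U R₁ R₀
    U→R₁↠R₀ = inj₁ (a , b , ≿min-strict a≢b , (λ _ _ → refl)
                   , (λ (a≿b , _) → minus-removes U a b (R₀⊆R₁ a b a≿b))
                   , λ x → Strict-⊆ R₀⊆U desc x b)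

    d-U-R₁ : d U R₁ ≈ pow2 0 * d (≿ab a b) (≿ab⁺ a b)
    d-U-R₁ = subst (λ k → d U R₁ ≈ pow2 k * d (≿ab a b) (≿ab⁺ a b))
                   (N≡0 {R = U} b (λ _ → ≿min-strict))
                   (proj₂ axiom3 U a b (≿min-isAO b) (≿min-strict a≢b))

    d-R₁-R₀ : d R₁ R₀ ≈ pow2 1 * d (≿ab c b) (≿ab⁺ c b)
    d-R₁-R₀ = subst (λ k → d R₁ R₀ ≈ pow2 k * d (≿ab c b) (≿ab⁺ c b))
                    (N≡1 {R = R₁} a≢b (λ (a≿b , _) → minus-removes U a b a≿b) R₁-x≻b)
                    (proj₂ axiom3 R₁ c b isAO-R₁ R₁-c≻b)

module _ (F : OrderedField) where
  open OrderedField F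
  private
    ring : CommutativeRing _ _
    ring = record { isCommutativeRing = isCommutativeRing }
    open CommutativeRing ring
      using (+-group; +-assoc; +-comm; +-cong; *-identityˡ; *-identityʳ; *-congʳ; distribʳ; setoid)
      renaming (sym to ≈-sym; refl to ≈-refl)
    open GroupProperties +-group using (∙-cancelˡ)
    open SetoidReasoning setoid

  x+2y≈y+2x⇒x≈y : ∀ x y → pow2 0 * x + pow2 1 * y ≈ pow2 0 * y + pow2 1 * x → x ≈ y
  x+2y≈y+2x⇒x≈y x y eq = ≈-sym (∙-cancelˡ (x + y) y x (begin
    (x + y) + y                 ≈⟨ +-assoc x y y ⟩
    x + (y + y)                 ≈⟨ expand x y ⟨
    pow2 0 * x + pow2 1 * y     ≈⟨ eq ⟩
    pow2 0 * y + pow2 1 * x     ≈⟨ expand y x ⟩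
    y + (x + x)                 ≈⟨ +-assoc y x x ⟨
    (y + x) + x                 ≈⟨ +-cong (+-comm y x) ≈-refl ⟩
    (x + y) + x                 ∎))
    where
    expand : ∀ u v → pow2 0 * u + pow2 1 * v ≈ u + (v + v)
    expand u v = +-cong (*-identityˡ u) (begin
      ((1# + 1#) * 1#) * v   ≈⟨ *-congʳ (*-identityʳ (1# + 1#)) ⟩
      (1# + 1#) * v          ≈⟨ distribʳ v 1# 1# ⟩
      1# * v + 1# * v        ≈⟨ +-cong (*-identityˡ v) (*-identityˡ v) ⟩
      v + v                  ∎)

lemma3p4 : (F : OrderedField) (n : ℕ) (d : Rel n → Rel n → OrderedField.Carrier F)
    → Extensional F d → Semimetric F d → Axiom1 F d → Axiom3 F d
    → (a b c : Fin n) → a ≢ b → b ≢ c → a ≢ c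
    → OrderedField._≈_ F (d (≿ab a b) (≿ab⁺ a b)) (d (≿ab c b) (≿ab⁺ c b))
lemma3p4 F n d ext _ axiom1 axiom3 a b c a≢b b≢c a≢c =
  x+2y≈y+2x⇒x≈y F (d (≿ab a b) (≿ab⁺ a b)) (d (≿ab c b) (≿ab⁺ c b)) (begin
    pow2 0 * d (≿ab a b) (≿ab⁺ a b) + pow2 1 * d (≿ab c b) (≿ab⁺ c b)
      ≈⟨ d-deleteTwice a≢b (b≢c ∘ sym) a≢c ⟨
    d (≿min b) (minus (minus (≿min b) a b) c b)
      ≈⟨ ext _ _ _ _ (λ _ _ → refl) (minus-comm (≿min b) a b c b) ⟩
    d (≿min b) (minus (minus (≿min b) c b) a b)
      ≈⟨ d-deleteTwice (b≢c ∘ sym) a≢b (a≢c ∘ sym) ⟩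
    pow2 0 * d (≿ab c b) (≿ab⁺ c b) + pow2 1 * d (≿ab a b) (≿ab⁺ a b) ∎)
  where
  open OrderedField F
  open DeleteTwice F d axiom1 axiom3
  open SetoidReasoning (IsCommutativeRing.setoid isCommutativeRing)
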